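{- Let $G$ be a connected graph of order at least two and let $D$ be a minimal certified dominating set of $G$. If $v$ is a vertex with $N_G[v]\subseteq D$, then $v$ is a leaf or a weak support of $G$. Moreover, the subgraph of $G$ induced by $\{v\in D\colon N_G[v]\subseteq D\}$ is a corona.
   Context: All graphs are finite and simple; $N_G[v]$ is the closed neighborhood of $v$. A leaf is a vertex of degree one; a support is the neighbor of a leaf; a support is strong if it is adjacent to at least two leaves and weak otherwise. A dominating set of $G$ is a set $D\subseteq V_G$ such that every vertex of $V_G-D$ has a neighbor in $D$. A certified dominating set is a dominating set $D$ such that every vertex in $D$ has either zero or at least two neighbors in $V_G-D$; it is minimal if no proper subset is a certified dominating set. A graph is a corona if it is isomorphic to $H\circ K_1$ for some graph $H$, i.e., obtained from $H$ by attaching one pendant vertex to each vertex of $H$. -}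

module Defs where

open import Data.Nat using (ℕ)
open import Data.Fin using (Fin)
open import Data.Fin.Subset using (Subset; _∈_; _∉_; _⊂_)
open import Data.Product using (Σ; ∃; ∃-syntax; _×_; _,_)
open import Data.Sum using (_⊎_; inj₁; inj₂)
open import Data.Empty using (⊥)
open import Relation.Nullary using (¬_; Dec)
open import Relation.Binary.PropositionalEquality using (_≡_; _≢_)
open import Function.Bundles using (_⇔_)

record Graph (n : ℕ) : Set₁ where
  field
    Adj    : Fin n → Fin n → Set
    sym    : ∀ {u v} → Adj u v → Adj v u
    irrefl : ∀ {v} → ¬ Adj v v
    dec    : ∀ u v → Dec (Adj u v)
open Graph public

module _ {n : ℕ} (G : Graph n) where

  data Walk : Fin n → Fin n → Set where
    here : ∀ {v} → Walk v v
    step : ∀ {u w v} → Adj G u w → Walk w v → Walk u v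

  Connected : Set
  Connected = ∀ u v → Walk u v

  Leaf : Fin n → Set
  Leaf v = ∃[ u ] (Adj G v u × (∀ w → Adj G v w → w ≡ u))

  Support : Fin n → Set
  Support s = ∃[ l ] (Adj G s l × Leaf l)

  StrongSupport : Fin n → Set
  StrongSupport s =
    ∃[ l₁ ] ∃[ l₂ ] (l₁ ≢ l₂ × Adj G s l₁ × Leaf l₁ × Adj G s l₂ × Leaf l₂)

  WeakSupport : Fin n → Set
  WeakSupport s = Support s × ¬ StrongSupport s

  ClosedNbhdIn : Fin n → Subset n → Set
  ClosedNbhdIn v D = v ∈ D × (∀ u → Adj G v u → u ∈ D)

  Dominating : Subset n → Set
  Dominating D = ∀ v → v ∉ D → ∃[ u ] (u ∈ D × Adj G v u)

  Certified : Subset n → Set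
  Certified D = ∀ v → v ∈ D →
    (∀ u → Adj G v u → u ∈ D)
    ⊎ (∃[ u ] ∃[ w ] (u ≢ w × Adj G v u × u ∉ D × Adj G v w × w ∉ D))

  CertifiedDominating : Subset n → Set
  CertifiedDominating D = Dominating D × Certified D

  MinimalCertifiedDominating : Subset n → Set
  MinimalCertifiedDominating D =
    CertifiedDominating D × (∀ D' → D' ⊂ D → ¬ CertifiedDominating D')

-- adjacency of the corona H ∘ K₁ on vertex set Fin k ⊎ Fin k:
-- inj₁ a are the vertices of H, inj₂ a is the pendant vertex attached to a.
CoronaAdj : ∀ {k} → Graph k → Fin k ⊎ Fin k → Fin k ⊎ Fin k → Set
CoronaAdj H (inj₁ a) (inj₁ b) = Adj H a b
CoronaAdj H (inj₁ a) (inj₂ b) = a ≡ b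
CoronaAdj H (inj₂ a) (inj₁ b) = a ≡ b
CoronaAdj H (inj₂ a) (inj₂ b) = ⊥

InducedIsCorona : ∀ {n} → Graph n → (Fin n → Set) → Set₁
InducedIsCorona {n} G P =
  Σ ℕ λ k → Σ (Graph k) λ H → Σ (Fin k ⊎ Fin k → Fin n) λ f →
      (∀ x → P (f x))
    × (∀ v → P v → ∃[ x ] (f x ≡ v))
    × (∀ x y → f x ≡ f y → x ≡ y)
    × (∀ x y → CoronaAdj H x y ⇔ Adj G (f x) (f y))

module Submission where

open import Defs
open import Data.Nat using (ℕ; _≤_; zero; suc; s≤s)
open import Data.Fin as Fin using (Fin; _<_)
open import Data.Fin.Properties using (_≟_; any?; all?; ¬∀⟶∃¬; <-cmp; <-asym; suc-injective)
open import Data.Fin.Subset using (Subset; _∈_; _∉_; _⊂_; _─_; _-_; ⁅_⁆; Empty; inside; outside)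
open import Data.Fin.Subset.Properties using (_∈?_; drop-there; x∈⁅x⁆; x∈⁅y⁆⇒x≡y; x∉⁅y⁆⇒x≢y)
open import Data.Fin.Subset.Induction using (⊂-wellFounded)
open import Data.Vec using (_∷_; here; there; tabulate)
open import Data.Vec.Properties using (lookup∘tabulate; lookup⇒[]=; []=⇒lookup)
open import Data.Product using (_×_; ∃-syntax; _,_; proj₁; proj₂)
open import Data.Sum using (_⊎_; inj₁; inj₂; [_,_])
open import Data.Bool using (true)
open import Data.Empty using (⊥-elim)
open import Function using (_∘_; id)
open import Function.Bundles using (_⇔_; mk⇔)
open import Induction.WellFounded using (Acc; acc)
open import Relation.Nullary using (¬_; yes; no; does)
open import Relation.Nullary.Decidable using (_×-dec_; _⊎-dec_; _→-dec_; ¬?)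
open import Relation.Unary using (Decidable)
open import Relation.Binary using (tri<; tri≈; tri>)
open import Relation.Binary.PropositionalEquality as ≡ using (_≡_; _≢_; refl; trans; cong; subst)

-- Write S = {v : N[v] ⊆ D}.  If X ⊆ S is nonempty, every vertex of X has a
-- neighbour outside X, and every vertex of S − X has zero or at least two
-- neighbours in X, then D − X is again certified dominating, contradicting
-- minimality.  The first condition need only be checked on leaves: a vertex
-- of X all of whose neighbours lie in X is then not a leaf, hence has two
-- neighbours, and can be dropped from X.  Taking for X the two leaves at a
-- strong support in S, a leaf in S whose support is not in S, or the vertices
-- of S that are neither leaves nor supports together with the leaves of S
-- whose support is adjacent to one of them, shows that S consists of leaves
-- and weak supports and contains the supports of its leaves.  Then S induces
-- the corona over its supports, where of each K₂-component only one end
-- counts as a support.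

private
  variable
    n : ℕ

x∈p─q⁺ : ∀ {x : Fin n} {p q} → x ∈ p → x ∉ q → x ∈ p ─ q
x∈p─q⁺ {q = inside  ∷ q} here        x∉q = ⊥-elim (x∉q here)
x∈p─q⁺ {q = outside ∷ q} here        x∉q = here
x∈p─q⁺ {q = _       ∷ q} (there x∈p) x∉q = there (x∈p─q⁺ {q = q} x∈p (x∉q ∘ there))

x∈p─q⁻ : ∀ {x : Fin n} p q → x ∈ p ─ q → x ∈ p × x ∉ q
x∈p─q⁻ (inside  ∷ p) (outside ∷ q) here = here , λ ()
x∈p─q⁻ {x = Fin.zero} (outside ∷ p) (inside  ∷ q) ()
x∈p─q⁻ {x = Fin.zero} (outside ∷ p) (outside ∷ q) ()
x∈p─q⁻ (_ ∷ p) (_ ∷ q) (there x∈p─q) with x∈p─q⁻ p q x∈p─q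
... | x∈p , x∉q = there x∈p , x∉q ∘ drop-there

x∈p-y⁺ : ∀ {x y : Fin n} {p} → x ∈ p → x ≢ y → x ∈ p - y
x∈p-y⁺ x∈p x≢y = x∈p─q⁺ x∈p (x≢y ∘ x∈⁅y⁆⇒x≡y _)

x∈p-y⁻ : ∀ {x y : Fin n} {p} → x ∈ p - y → x ∈ p × x ≢ y
x∈p-y⁻ {y = y} {p} x∈p-y with x∈p─q⁻ p ⁅ y ⁆ x∈p-y
... | x∈p , x∉⁅y⁆ = x∈p , x∉⁅y⁆⇒x≢y x∉⁅y⁆

p-y⊂p : ∀ {y : Fin n} {p} → y ∈ p → p - y ⊂ p
p-y⊂p y∈p = proj₁ ∘ x∈p-y⁻ , _ , y∈p , λ y∈p-y → proj₂ (x∈p-y⁻ y∈p-y) refl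

module _ {n : ℕ} {P : Fin n → Set} (P? : Decidable P) where

  toSubset : Subset n
  toSubset = tabulate (does ∘ P?)

  private
    does-true : ∀ x → does (P? x) ≡ true → P x
    does-true x eq with P? x
    ... | yes px = px

    does-P : ∀ x → P x → does (P? x) ≡ true
    does-P x px with P? x
    ... | yes _  = refl
    ... | no ¬px = ⊥-elim (¬px px)

  ∈-toSubset⁺ : ∀ {x} → P x → x ∈ toSubset
  ∈-toSubset⁺ {x} px = lookup⇒[]= x toSubset (trans (lookup∘tabulate _ x) (does-P x px))

  ∈-toSubset⁻ : ∀ {x} → x ∈ toSubset → P x
  ∈-toSubset⁻ {x} x∈ = does-true x (trans (≡.sym (lookup∘tabulate _ x)) ([]=⇒lookup x∈))

record Enumeration {n : ℕ} (P : Fin n → Set) : Set where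
  field
    size        : ℕ
    elem        : Fin size → Fin n
    elem-∈      : ∀ a → P (elem a)
    elem-onto   : ∀ {v} → P v → ∃[ a ] (elem a ≡ v)
    elem-injective : ∀ {a b} → elem a ≡ elem b → a ≡ b

module _ {n : ℕ} {P : Fin (suc n) → Set} where

  enumeration-include₀ : P Fin.zero → Enumeration (P ∘ Fin.suc) → Enumeration P
  enumeration-include₀ p₀ E = record
    { size = suc size ; elem = elem′ ; elem-∈ = elem′-∈ ; elem-onto = onto ; elem-injective = injective }
    where
    open Enumeration E
    elem′ : Fin (suc size) → Fin (suc n)
    elem′ Fin.zero    = Fin.zero
    elem′ (Fin.suc a) = Fin.suc (elem a)
    elem′-∈ : ∀ a → P (elem′ a)
    elem′-∈ Fin.zero    = p₀
    elem′-∈ (Fin.suc a) = elem-∈ a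
    onto : ∀ {v} → P v → ∃[ a ] (elem′ a ≡ v)
    onto {Fin.zero}  _  = Fin.zero , refl
    onto {Fin.suc v} pv with elem-onto pv
    ... | a , refl = Fin.suc a , refl
    injective : ∀ {a b} → elem′ a ≡ elem′ b → a ≡ b
    injective {Fin.zero}  {Fin.zero}  _  = refl
    injective {Fin.suc a} {Fin.suc b} eq = cong Fin.suc (elem-injective (suc-injective eq))

  enumeration-exclude₀ : ¬ P Fin.zero → Enumeration (P ∘ Fin.suc) → Enumeration P
  enumeration-exclude₀ ¬p₀ E = record
    { size = size ; elem = Fin.suc ∘ elem ; elem-∈ = elem-∈ ; elem-onto = onto
    ; elem-injective = elem-injective ∘ suc-injective }
    where
    open Enumeration E
    onto : ∀ {v} → P v → ∃[ a ] (Fin.suc (elem a) ≡ v)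
    onto {Fin.zero}  p₀ = ⊥-elim (¬p₀ p₀)
    onto {Fin.suc v} pv with elem-onto pv
    ... | a , refl = a , refl

enumerate : ∀ {n} {P : Fin n → Set} → Decidable P → Enumeration P
enumerate {zero} P? = record
  { size = 0 ; elem = λ () ; elem-∈ = λ () ; elem-onto = λ { {()} } ; elem-injective = λ { {()} } }
enumerate {suc n} P? with P? Fin.zero
... | yes p₀ = enumeration-include₀ p₀ (enumerate (P? ∘ Fin.suc))
... | no ¬p₀ = enumeration-exclude₀ ¬p₀ (enumerate (P? ∘ Fin.suc))

HasNoIsolatedVertex : ∀ {n} → Graph n → Set
HasNoIsolatedVertex {n} G = ∀ (v : Fin n) → ∃[ u ] Adj G v u

connected⇒hasNoIsolatedVertex : ∀ {n} (G : Graph n) → 2 ≤ n → Connected G → HasNoIsolatedVertex G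
connected⇒hasNoIsolatedVertex {suc (suc _)} G (s≤s (s≤s _)) connected v =
  first-edge (connected v (other v)) (other≢ v)
  where
  other : Fin _ → Fin _
  other Fin.zero    = Fin.suc Fin.zero
  other (Fin.suc _) = Fin.zero
  other≢ : ∀ v → other v ≢ v
  other≢ Fin.zero    ()
  other≢ (Fin.suc _) ()
  first-edge : ∀ {v w} → Walk G v w → w ≢ v → ∃[ u ] Adj G v u
  first-edge here         w≢v = ⊥-elim (w≢v refl)
  first-edge (step vu _) _   = _ , vu

module _ {n : ℕ} (G : Graph n) where

  private
    variable
      u v w l s : Fin n

  ¬∀-neighbour⇒∃-neighbour : ∀ {Q : Fin n → Set} → Decidable Q →
    ¬ (∀ u → Adj G v u → Q u) → ∃[ u ] (Adj G v u × ¬ Q u)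
  ¬∀-neighbour⇒∃-neighbour {v} Q? ¬all with ¬∀⟶∃¬ n _ (λ u → dec G v u →-dec Q? u) ¬all
  ... | u , ¬[vu⇒Qu] with dec G v u
  ...   | yes vu  = u , vu , ¬[vu⇒Qu] ∘ (λ qu _ → qu)
  ...   | no ¬vu = ⊥-elim (¬[vu⇒Qu] (⊥-elim ∘ ¬vu))

  leaf⇒neighbour-unique : Leaf G l → Adj G l u → Adj G l w → u ≡ w
  leaf⇒neighbour-unique (_ , _ , only) lu lw = trans (only _ lu) (≡.sym (only _ lw))

  ¬leaf⇒second-neighbour : ¬ Leaf G v → Adj G v u → ∃[ w ] (Adj G v w × w ≢ u)
  ¬leaf⇒second-neighbour {u = u} ¬leaf vu =
    ¬∀-neighbour⇒∃-neighbour (_≟ u) (λ only → ¬leaf (u , vu , only))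

  ¬strong⇒leaf-unique : ¬ StrongSupport G s → Adj G s u → Leaf G u → Adj G s w → Leaf G w → u ≡ w
  ¬strong⇒leaf-unique {u = u} {w = w} ¬strong su leaf₁ sw leaf₂ with u ≟ w
  ... | yes u≡w = u≡w
  ... | no  u≢w = ⊥-elim (¬strong (u , w , u≢w , su , leaf₁ , sw , leaf₂))

  leaf? : Decidable (Leaf G)
  leaf? v = any? λ u → dec G v u ×-dec all? (λ w → dec G v w →-dec (w ≟ u))

  support? : Decidable (Support G)
  support? s = any? λ l → dec G s l ×-dec leaf? l

  module Corona {P : Fin n → Set} (P? : Decidable P)
    (leaf⊎support  : ∀ {v} → P v → Leaf G v ⊎ Support G v)
    (¬strong       : ∀ {v} → P v → ¬ StrongSupport G v)
    (leaf-closed   : ∀ {s l} → P s → Adj G s l → Leaf G l → P l)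
    (support-closed : ∀ {l s} → P l → Leaf G l → Adj G l s → P s)
    where

    -- Both ends of a K₂-component are leaves and supports; only the smaller
    -- one is taken as a centre.
    Centre : Fin n → Set
    Centre v = P v × Support G v × (Leaf G v → ∀ u → Adj G v u → v < u)

    centre? : Decidable Centre
    centre? v = P? v ×-dec support? v ×-dec
                (leaf? v →-dec all? λ u → dec G v u →-dec (v Fin.<? u))

    centre-of-K₂ : P v → Leaf G v → Adj G v s → Leaf G s → v < s → Centre v
    centre-of-K₂ {v} pv leaf vs leafₛ v<s =
      pv , (_ , vs , leafₛ) , λ _ u vu → subst (v <_) (leaf⇒neighbour-unique leaf vs vu) v<s

    centre⊎pendant : P v → Centre v ⊎ ∃[ s ] (Centre s × Adj G s v × Leaf G v)
    centre⊎pendant {v} pv with leaf? v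
    ... | no ¬leaf = inj₁ (pv , [ ⊥-elim ∘ ¬leaf , id ] (leaf⊎support pv) , ⊥-elim ∘ ¬leaf)
    ... | yes leaf@(s , vs , _) with leaf? s
    ...   | no ¬leafₛ =
            inj₂ (s , (support-closed pv leaf vs , (v , G .sym vs , leaf) , ⊥-elim ∘ ¬leafₛ) , G .sym vs , leaf)
    ...   | yes leafₛ with <-cmp v s
    ...     | tri< v<s _ _ = inj₁ (centre-of-K₂ pv leaf vs leafₛ v<s)
    ...     | tri≈ _ refl _ = ⊥-elim (G .irrefl vs)
    ...     | tri> _ _ s<v =
              inj₂ (s , centre-of-K₂ (support-closed pv leaf vs) leafₛ (G .sym vs) leaf s<v , G .sym vs , leaf)

    open Enumeration (enumerate centre?) renaming (elem to centre)

    centre-support : ∀ a → Support G (centre a)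
    centre-support a = proj₁ (proj₂ (elem-∈ a))

    centre-smaller : ∀ a → Leaf G (centre a) → ∀ u → Adj G (centre a) u → centre a < u
    centre-smaller a = proj₂ (proj₂ (elem-∈ a))

    pendant : Fin size → Fin n
    pendant a = proj₁ (centre-support a)

    centre-pendant : ∀ a → Adj G (centre a) (pendant a)
    centre-pendant a = proj₁ (proj₂ (centre-support a))

    pendant-leaf : ∀ a → Leaf G (pendant a)
    pendant-leaf a = proj₂ (proj₂ (centre-support a))

    pendant-adj⇒centre : ∀ a → Adj G (pendant a) u → u ≡ centre a
    pendant-adj⇒centre a pu = leaf⇒neighbour-unique (pendant-leaf a) pu (G .sym (centre-pendant a))

    -- Otherwise both ends of a K₂-component would be centres, each smaller
    -- than the other.
    centre≢pendant : ∀ a b → centre a ≢ pendant b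
    centre≢pendant a b eq = <-asym ca<cb cb<ca
      where
      leaf-ca : Leaf G (centre a)
      leaf-ca = subst (Leaf G) (≡.sym eq) (pendant-leaf b)
      ca-cb : Adj G (centre a) (centre b)
      ca-cb = subst (λ t → Adj G t (centre b)) (≡.sym eq) (G .sym (centre-pendant b))
      ca<cb : centre a < centre b
      ca<cb = centre-smaller a leaf-ca _ ca-cb
      leaf-cb : Leaf G (centre b)
      leaf-cb = subst (Leaf G) (leaf⇒neighbour-unique leaf-ca (centre-pendant a) ca-cb) (pendant-leaf a)
      cb<ca : centre b < centre a
      cb<ca = subst (centre b <_) (≡.sym eq) (centre-smaller b leaf-cb _ (centre-pendant b))

    H : Graph size
    H = record { Adj = λ a b → Adj G (centre a) (centre b) ; sym = G .sym ; irrefl = G .irrefl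
               ; dec = λ a b → dec G (centre a) (centre b) }

    embed : Fin size ⊎ Fin size → Fin n
    embed (inj₁ a) = centre a
    embed (inj₂ a) = pendant a

    embed-∈ : ∀ x → P (embed x)
    embed-∈ (inj₁ a) = proj₁ (elem-∈ a)
    embed-∈ (inj₂ a) = leaf-closed (proj₁ (elem-∈ a)) (centre-pendant a) (pendant-leaf a)

    embed-onto : ∀ v → P v → ∃[ x ] (embed x ≡ v)
    embed-onto v pv with centre⊎pendant pv
    ... | inj₁ centreᵥ = let a , eq = elem-onto centreᵥ in inj₁ a , eq
    ... | inj₂ (s , centreₛ , sv , leaf) with elem-onto centreₛ
    ...   | a , refl = inj₂ a , ¬strong⇒leaf-unique (¬strong (proj₁ centreₛ))
                                  (centre-pendant a) (pendant-leaf a) sv leaf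

    embed-injective : ∀ x y → embed x ≡ embed y → x ≡ y
    embed-injective (inj₁ a) (inj₁ b) eq = cong inj₁ (elem-injective eq)
    embed-injective (inj₁ a) (inj₂ b) eq = ⊥-elim (centre≢pendant a b eq)
    embed-injective (inj₂ a) (inj₁ b) eq = ⊥-elim (centre≢pendant b a (≡.sym eq))
    embed-injective (inj₂ a) (inj₂ b) eq = cong inj₂ (elem-injective (≡.sym (pendant-adj⇒centre a pa-cb)))
      where
      pa-cb : Adj G (pendant a) (centre b)
      pa-cb = subst (λ t → Adj G t (centre b)) (≡.sym eq) (G .sym (centre-pendant b))

    embed-adj : ∀ x y → CoronaAdj H x y ⇔ Adj G (embed x) (embed y)
    embed-adj (inj₁ a) (inj₁ b) = mk⇔ id id
    embed-adj (inj₁ a) (inj₂ b) = mk⇔ (λ { refl → centre-pendant a })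
                                      (λ ca-pb → elem-injective (pendant-adj⇒centre b (G .sym ca-pb)))
    embed-adj (inj₂ a) (inj₁ b) = mk⇔ (λ { refl → G .sym (centre-pendant a) })
                                      (λ pa-cb → elem-injective (≡.sym (pendant-adj⇒centre a pa-cb)))
    embed-adj (inj₂ a) (inj₂ b) = mk⇔ (λ ())
                                      (λ pa-pb → centre≢pendant a b (≡.sym (pendant-adj⇒centre a pa-pb)))

    induced-corona : InducedIsCorona G P
    induced-corona = size , H , embed , embed-∈ , embed-onto , embed-injective , embed-adj

  OuterNeighbour : Subset n → Fin n → Set
  OuterNeighbour X x = ∃[ u ] (Adj G x u × u ∉ X)

  ZeroOrTwoNeighboursIn : Subset n → Fin n → Set
  ZeroOrTwoNeighboursIn X z =
    (∀ u → Adj G z u → u ∉ X) ⊎ ∃[ u ] ∃[ w ] (u ≢ w × Adj G z u × u ∈ X × Adj G z w × w ∈ X)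

  Exits : Subset n → Set
  Exits X = ∀ {x} → x ∈ X → OuterNeighbour X x

  LeavesExit : Subset n → Set
  LeavesExit X = ∀ {x} → x ∈ X → Leaf G x → OuterNeighbour X x

  module _ (D : Subset n) where

    Interior : Fin n → Set
    Interior v = ClosedNbhdIn G v D

    interior? : Decidable Interior
    interior? v = (v ∈? D) ×-dec all? λ u → dec G v u →-dec (u ∈? D)

    interior-leaf-closed : Interior s → Adj G s l → Leaf G l → Interior l
    interior-leaf-closed (s∈D , N[s]⊆D) sl leaf =
      N[s]⊆D _ sl , λ u lu → subst (_∈ D) (leaf⇒neighbour-unique leaf (G .sym sl) lu) s∈D

    record Removable (X : Subset n) : Set where
      field
        ⊆interior  : ∀ {x} → x ∈ X → Interior x
        zero-or-two : ∀ {z} → Interior z → z ∉ X → ZeroOrTwoNeighboursIn X z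

    ─-certifiedDominating : ∀ {X} → CertifiedDominating G D → Removable X →
      Exits X → CertifiedDominating G (D ─ X)
    ─-certifiedDominating {X} (dominating , certified) removable exits = dominating′ , certified′
      where
      open Removable removable
      ∉D─X : ∀ {u} → u ∉ D → u ∉ D ─ X
      ∉D─X u∉D = u∉D ∘ proj₁ ∘ x∈p─q⁻ D X

      -- A vertex outside D has no neighbour in X ⊆ Interior, so keeps its dominator.
      dominating′ : Dominating G (D ─ X)
      dominating′ v v∉D─X with v ∈? D
      ... | no v∉D with dominating v v∉D
      ...   | u , u∈D , vu = u , x∈p─q⁺ u∈D (λ u∈X → v∉D (proj₂ (⊆interior u∈X) v (G .sym vu))) , vu
      dominating′ v v∉D─X | yes v∈D with v ∈? X
      ... | no v∉X  = ⊥-elim (v∉D─X (x∈p─q⁺ v∈D v∉X))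
      ... | yes v∈X with exits v∈X
      ...   | u , vu , u∉X = u , x∈p─q⁺ (proj₂ (⊆interior v∈X) u vu) u∉X , vu

      certified′ : Certified G (D ─ X)
      certified′ v v∈D─X with x∈p─q⁻ D X v∈D─X
      ... | v∈D , v∉X with certified v v∈D
      ...   | inj₂ (u , w , u≢w , vu , u∉D , vw , w∉D) =
                inj₂ (u , w , u≢w , vu , ∉D─X u∉D , vw , ∉D─X w∉D)
      ...   | inj₁ N[v]⊆D with zero-or-two (v∈D , N[v]⊆D) v∉X
      ...     | inj₁ none = inj₁ λ u vu → x∈p─q⁺ (N[v]⊆D u vu) (none u vu)
      ...     | inj₂ (u , w , u≢w , vu , u∈X , vw , w∈X) =
                inj₂ (u , w , u≢w , vu , (λ u∈ → proj₂ (x∈p─q⁻ D X u∈) u∈X) ,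
                      vw , (λ w∈ → proj₂ (x∈p─q⁻ D X w∈) w∈X))

    removable-drop : ∀ {X y u w} → Removable X → y ∈ X → (∀ t → Adj G y t → t ∈ X) →
      u ≢ w → Adj G y u → Adj G y w → Removable (X - y)
    removable-drop {X} {y} {u} {w} removable y∈X N[y]⊆X u≢w yu yw = record
      { ⊆interior = ⊆interior ∘ proj₁ ∘ x∈p-y⁻ ; zero-or-two = zero-or-two′ }
      where
      open Removable removable
      ≢y : ∀ {z t} → Adj G z t → z ∉ X → t ≢ y
      ≢y zt z∉X refl = z∉X (N[y]⊆X _ (G .sym zt))
      zero-or-two′ : ∀ {z} → Interior z → z ∉ X - y → ZeroOrTwoNeighboursIn (X - y) z
      zero-or-two′ {z} interior z∉X-y with z ≟ y
      ... | yes refl = inj₂ (u , w , u≢w , yu , x∈p-y⁺ (N[y]⊆X u yu) (≢irrefl yu) ,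
                                         yw , x∈p-y⁺ (N[y]⊆X w yw) (≢irrefl yw))
        where
        ≢irrefl : ∀ {t} → Adj G y t → t ≢ y
        ≢irrefl yt refl = G .irrefl yt
      ... | no z≢y with z ∈? X
      ...   | yes z∈X = ⊥-elim (z∉X-y (x∈p-y⁺ z∈X z≢y))
      ...   | no z∉X with zero-or-two interior z∉X
      ...     | inj₁ none = inj₁ λ t zt → none t zt ∘ proj₁ ∘ x∈p-y⁻
      ...     | inj₂ (t , t′ , t≢t′ , zt , t∈X , zt′ , t′∈X) =
                inj₂ (t , t′ , t≢t′ , zt , x∈p-y⁺ t∈X (≢y zt z∉X) , zt′ , x∈p-y⁺ t′∈X (≢y zt′ z∉X))

    Bare : Fin n → Set
    Bare b = Interior b × ¬ Leaf G b × ¬ Support G b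

    bare? : Decidable Bare
    bare? b = interior? b ×-dec ¬? (leaf? b) ×-dec ¬? (support? b)

    LeafNearBare : Fin n → Set
    LeafNearBare l = Interior l × Leaf G l × ∃[ s ] (Adj G l s × ∃[ b ] (Bare b × Adj G s b))

    bareRegion? : Decidable λ x → Bare x ⊎ LeafNearBare x
    bareRegion? x = bare? x ⊎-dec (interior? x ×-dec leaf? x ×-dec
                      any? λ s → dec G x s ×-dec any? λ b → bare? b ×-dec dec G s b)

    BareRegion : Subset n
    BareRegion = toSubset bareRegion?

    bareRegion-leavesExit : LeavesExit BareRegion
    bareRegion-leavesExit {y} y∈X leaf with ∈-toSubset⁻ bareRegion? y∈X
    ... | inj₁ (_ , ¬leaf , _) = ⊥-elim (¬leaf leaf)
    ... | inj₂ (_ , _ , s , ys , b , bare , sb) = s , ys , s∉X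
      where
      s∉X : s ∉ BareRegion
      s∉X s∈X with ∈-toSubset⁻ bareRegion? s∈X
      ... | inj₁ (_ , _ , ¬supportₛ) = ¬supportₛ (y , G .sym ys , leaf)
      ... | inj₂ (_ , leafₛ , _) with leaf⇒neighbour-unique leafₛ sb (G .sym ys)
      ...   | refl = proj₁ (proj₂ bare) leaf

    bareRegion-removable : Removable BareRegion
    bareRegion-removable = record
      { ⊆interior = [ proj₁ , proj₁ ] ∘ ∈-toSubset⁻ bareRegion? ; zero-or-two = zero-or-two }
      where
      zero-or-two : ∀ {z} → Interior z → z ∉ BareRegion → ZeroOrTwoNeighboursIn BareRegion z
      zero-or-two {z} interior z∉X with any? (λ b → bare? b ×-dec dec G z b)
      ... | no ¬bare-neighbour = inj₁ λ u zu u∈X → ¬bare-neighbour (near (∈-toSubset⁻ bareRegion? u∈X) zu)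
        where
        near : ∀ {u} → Bare u ⊎ LeafNearBare u → Adj G z u → ∃[ b ] (Bare b × Adj G z b)
        near (inj₁ bareᵤ) zu = _ , bareᵤ , zu
        near (inj₂ (_ , leafᵤ , s , us , b , bare , sb)) zu
          with leaf⇒neighbour-unique leafᵤ us (G .sym zu)
        ... | refl = b , bare , sb
      ... | yes (b , bare , zb) with support? z
      ...   | no ¬support =
              ⊥-elim (z∉X (∈-toSubset⁺ bareRegion? (inj₁ (interior , ¬leaf , ¬support))))
        where
        ¬leaf : ¬ Leaf G z
        ¬leaf leaf = proj₂ (proj₂ bare) (z , G .sym zb , leaf)
      ...   | yes (l , zl , leafₗ) =
              inj₂ (b , l , (λ { refl → proj₁ (proj₂ bare) leafₗ }) , zb ,
                    ∈-toSubset⁺ bareRegion? (inj₁ bare) , zl ,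
                    ∈-toSubset⁺ bareRegion? (inj₂ (interior-leaf-closed interior zl leafₗ , leafₗ ,
                                                   z , G .sym zl , b , bare , zb)))

  module _ {D : Subset n} (minimal : MinimalCertifiedDominating G D) where

    removable∧exits⇒empty : ∀ {X} → Removable D X → Exits X → Empty X
    removable∧exits⇒empty {X} removable exits (x , x∈X) =
      proj₂ minimal (D ─ X) D─X⊂D (─-certifiedDominating D (proj₁ minimal) removable exits)
      where
      D─X⊂D : D ─ X ⊂ D
      D─X⊂D = proj₁ ∘ x∈p─q⁻ D X , x , proj₁ (Removable.⊆interior removable x∈X) ,
              λ x∈D─X → proj₂ (x∈p─q⁻ D X x∈D─X) x∈X

    removable∧leavesExit⇒empty : HasNoIsolatedVertex G → ∀ {X} → Removable D X →
      LeavesExit X → Empty X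
    removable∧leavesExit⇒empty noIsolated = go (⊂-wellFounded _)
      where
      go : ∀ {X} → Acc _⊂_ X → Removable D X → LeavesExit X → Empty X
      go {X} (acc smaller) removable leaves-exit nonempty
        with any? (λ y → (y ∈? X) ×-dec all? (λ t → dec G y t →-dec (t ∈? X)))
      ... | no ¬trapped = removable∧exits⇒empty removable exits nonempty
        where
        exits : Exits X
        exits {x} x∈X = ¬∀-neighbour⇒∃-neighbour (_∈? X) (λ N[x]⊆X → ¬trapped (x , x∈X , N[x]⊆X))
      ... | yes (y , y∈X , N[y]⊆X) with noIsolated y
      ...   | u , yu with ¬leaf⇒second-neighbour ¬leaf yu
        where
        ¬leaf : ¬ Leaf G y
        ¬leaf leaf = let t , yt , t∉X = leaves-exit y∈X leaf in t∉X (N[y]⊆X t yt)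
      ...     | w , yw , w≢u =
        go (smaller (p-y⊂p y∈X)) (removable-drop D removable y∈X N[y]⊆X (w≢u ∘ ≡.sym) yu yw)
           (λ x∈ leaf → let t , xt , t∉X = leaves-exit (proj₁ (x∈p-y⁻ x∈)) leaf
                        in t , xt , t∉X ∘ proj₁ ∘ x∈p-y⁻)
           (u , x∈p-y⁺ (N[y]⊆X u yu) λ { refl → G .irrefl yu })

    interior⇒¬strongSupport : Interior D v → ¬ StrongSupport G v
    interior⇒¬strongSupport {v} interior (l₁ , l₂ , l₁≢l₂ , vl₁ , leaf₁ , vl₂ , leaf₂) =
      removable∧exits⇒empty {X} removable exits (l₁ , ∈-toSubset⁺ X? (inj₁ refl))
      where
      X? : Decidable λ x → x ≡ l₁ ⊎ x ≡ l₂
      X? x = (x ≟ l₁) ⊎-dec (x ≟ l₂)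
      X : Subset n
      X = toSubset X?
      v∉X : v ∉ X
      v∉X v∈X with ∈-toSubset⁻ X? v∈X
      ... | inj₁ refl = G .irrefl vl₁
      ... | inj₂ refl = G .irrefl vl₂
      removable : Removable D X
      removable = record { ⊆interior = ⊆interior ; zero-or-two = zero-or-two }
        where
        ⊆interior : ∀ {x} → x ∈ X → Interior D x
        ⊆interior x∈X with ∈-toSubset⁻ X? x∈X
        ... | inj₁ refl = interior-leaf-closed D interior vl₁ leaf₁
        ... | inj₂ refl = interior-leaf-closed D interior vl₂ leaf₂
        zero-or-two : ∀ {z} → Interior D z → z ∉ X → ZeroOrTwoNeighboursIn X z
        zero-or-two {z} _ _ with z ≟ v
        ... | yes refl = inj₂ (l₁ , l₂ , l₁≢l₂ , vl₁ , ∈-toSubset⁺ X? (inj₁ refl) ,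
                                              vl₂ , ∈-toSubset⁺ X? (inj₂ refl))
        ... | no z≢v = inj₁ λ u zu u∈X → z≢v (leaf-neighbour≡v (∈-toSubset⁻ X? u∈X) zu)
          where
          leaf-neighbour≡v : ∀ {u} → u ≡ l₁ ⊎ u ≡ l₂ → Adj G z u → z ≡ v
          leaf-neighbour≡v (inj₁ refl) zu = leaf⇒neighbour-unique leaf₁ (G .sym zu) (G .sym vl₁)
          leaf-neighbour≡v (inj₂ refl) zu = leaf⇒neighbour-unique leaf₂ (G .sym zu) (G .sym vl₂)
      exits : Exits X
      exits x∈X with ∈-toSubset⁻ X? x∈X
      ... | inj₁ refl = v , G .sym vl₁ , v∉X
      ... | inj₂ refl = v , G .sym vl₂ , v∉X

    interior-support-closed : Interior D l → Leaf G l → Adj G l s → Interior D s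
    interior-support-closed {l} {s} interiorₗ leaf ls with interior? D s
    ... | yes interiorₛ = interiorₛ
    ... | no ¬interiorₛ = ⊥-elim (removable∧exits⇒empty removable exits (l , x∈⁅x⁆ l))
      where
      removable : Removable D ⁅ l ⁆
      removable = record
        { ⊆interior = λ x∈ → subst (Interior D) (≡.sym (x∈⁅y⁆⇒x≡y l x∈)) interiorₗ
        ; zero-or-two = λ {z} interior′ _ → inj₁ λ u zu u∈ →
            ¬interiorₛ (subst (Interior D) (neighbour≡s (subst (Adj G z) (x∈⁅y⁆⇒x≡y l u∈) zu)) interior′)
        }
        where
        neighbour≡s : ∀ {z} → Adj G z l → z ≡ s
        neighbour≡s zl = leaf⇒neighbour-unique leaf (G .sym zl) ls
      exits : Exits ⁅ l ⁆
      exits x∈ with x∈⁅y⁆⇒x≡y l x∈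
      ... | refl = s , ls , λ s∈ → G .irrefl (subst (Adj G l) (x∈⁅y⁆⇒x≡y l s∈) ls)

    interior⇒leaf⊎support : HasNoIsolatedVertex G → Interior D v → Leaf G v ⊎ Support G v
    interior⇒leaf⊎support {v} noIsolated interior with leaf? v | support? v
    ... | yes leaf | _           = inj₁ leaf
    ... | no _     | yes support = inj₂ support
    ... | no ¬leaf | no ¬support =
      ⊥-elim (removable∧leavesExit⇒empty noIsolated (bareRegion-removable D) (bareRegion-leavesExit D)
                (v , ∈-toSubset⁺ (bareRegion? D) (inj₁ (interior , ¬leaf , ¬support))))

lemma3p1 : ∀ {n : ℕ} (G : Graph n) → 2 ≤ n → Connected G →
    (D : Subset n) → MinimalCertifiedDominating G D →
    (∀ v → ClosedNbhdIn G v D → Leaf G v ⊎ WeakSupport G v)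
    × InducedIsCorona G (λ v → ClosedNbhdIn G v D)
lemma3p1 G two connected D minimal = leaf⊎weakSupport , induced-corona
  where
  noIsolated : HasNoIsolatedVertex G
  noIsolated = connected⇒hasNoIsolatedVertex G two connected
  leaf⊎weakSupport : ∀ v → Interior G D v → Leaf G v ⊎ WeakSupport G v
  leaf⊎weakSupport v interior with interior⇒leaf⊎support G minimal noIsolated interior
  ... | inj₁ leaf    = inj₁ leaf
  ... | inj₂ support = inj₂ (support , interior⇒¬strongSupport G minimal interior)
  open Corona G (interior? G D) (interior⇒leaf⊎support G minimal noIsolated)
    (interior⇒¬strongSupport G minimal) (interior-leaf-closed G D) (interior-support-closed G minimal)
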